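{- Let $A\in\mathcal P_{\mathrm{fin},0}(\mathbb N_0)$ satisfy $\gcd(A)=1$, let $S=\langle A\rangle$ and $T=\langle\mathrm{rev}(A)\rangle$, and let $n^*(A)\in\mathbb N$ be such that $nA=\langle A\rangle\cap\big(n\max A-\langle\mathrm{rev}(A)\rangle\big)$ for all $n\ge n^*(A)$. Then for all $B\in\mathcal P_{\mathrm{fin},0}(S)\cap\mathrm{rev}(\mathcal P_{\mathrm{fin},0}(T))$ and all integers $N\ge n^*(A)$ with \[\max\Delta(B)<N\max A-\mathsf F(S)-\mathsf F(T)-\max B,\] the set $B$ divides $NA$ in $\mathcal P_{\mathrm{fin},0}(\mathbb N_0)$.
   Context: $\mathcal P_{\mathrm{fin},0}(S)$ (for a submonoid $S\subset\mathbb N_0$) is the monoid of finite subsets of $S$ containing $0$ under set addition $X+Y=\{x+y\colon x\in X,y\in Y\}$. $nA=A+\dots+A$ ($n$ summands) is the $n$-fold sumset, and for an integer $m$ and a set $X$, $m-X=\{m-x\colon x\in X\}$. $\langle X\rangle$ is the submonoid of $\mathbb N_0$ generated by $X$. For $B\in\mathcal P_{\mathrm{fin},0}(\mathbb N_0)$, $\mathrm{rev}(B)=\max B-B$, and $\mathrm{rev}(H)=\{\mathrm{rev}(B)\colon B\in H\}$. Such an $n^*(A)$ always exists (a known result of Nathanson). For a numerical monoid $S$ (a submonoid of $\mathbb N_0$ with $\gcd 1$), $\mathsf F(S)=\max(\mathbb N_0\setminus S)$ is its Frobenius number, with $\mathsf F(\mathbb N_0)=0$. For a finite set $B\subset\mathbb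 Z$, $\Delta(B)$ is the set of $d\in\mathbb N$ such that $B\cap[b,b+d]=\{b,b+d\}$ for some $b\in B$ (the gaps between consecutive elements). $B$ divides $D$ in $\mathcal P_{\mathrm{fin},0}(\mathbb N_0)$ if $D=B+C$ for some $C\in\mathcal P_{\mathrm{fin},0}(\mathbb N_0)$. -}

module Defs where

open import Data.Nat using (ℕ; zero; suc; _+_; _*_; _∸_; _≤_; _<_; _⊔_)
open import Data.Nat.GCD using (gcd)
open import Data.List using (List; []; _∷_; foldr; map; concatMap)
open import Data.List.Membership.Propositional using (_∈_)
open import Data.Product using (_×_; ∃; ∃-syntax; Σ)
open import Data.Sum using (_⊎_)
open import Relation.Binary.PropositionalEquality using (_≡_)
open import Relation.Nullary using (¬_)

-- Finite subsets of ℕ₀ are represented by lists (set semantics: only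
-- membership matters; duplicates and order are irrelevant).

_≈ₛ_ : List ℕ → List ℕ → Set
X ≈ₛ Y = ∀ x → (x ∈ X → x ∈ Y) × (x ∈ Y → x ∈ X)

gcdL : List ℕ → ℕ
gcdL = foldr gcd 0

-- max of a finite subset of ℕ₀ (max ∅ = 0; only used on nonempty sets).
maxL : List ℕ → ℕ
maxL = foldr _⊔_ 0

rev : List ℕ → List ℕ
rev B = map (λ b → maxL B ∸ b) B

_⊕_ : List ℕ → List ℕ → List ℕ
X ⊕ Y = concatMap (λ x → map (x +_) Y) X

_·ₛ_ : ℕ → List ℕ → List ℕ
zero  ·ₛ A = 0 ∷ []
suc n ·ₛ A = A ⊕ (n ·ₛ A)

data ⟨_⟩ (X : List ℕ) : ℕ → Set where
  mon-zero : ⟨ X ⟩ 0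
  mon-add  : ∀ {x m} → x ∈ X → ⟨ X ⟩ m → ⟨ X ⟩ (x + m)

-- f is the Frobenius number F(S) = max(ℕ₀ ∖ S) of the submonoid S
-- (given as a predicate), with the convention F(ℕ₀) = 0.
IsFrobenius : (ℕ → Set) → ℕ → Set
IsFrobenius S f = (∀ x → f < x → S x) × (f ≡ 0 ⊎ ¬ S f)

InΔ : List ℕ → ℕ → Set
InΔ B d = 1 ≤ d × Σ ℕ λ b → b ∈ B × (b + d) ∈ B ×
            (∀ x → x ∈ B → b ≤ x → x ≤ b + d → x ≡ b ⊎ x ≡ b + d)

InPfin0 : List ℕ → List ℕ → Set
InPfin0 X B = 0 ∈ B × (∀ b → b ∈ B → ⟨ X ⟩ b)

_∣ₚ_ : List ℕ → List ℕ → Set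
B ∣ₚ D = Σ (List ℕ) λ C → 0 ∈ C × D ≈ₛ (B ⊕ C)

{-# OPTIONS --safe #-}
module Submission where

open import Defs
open import Data.Nat using (ℕ; zero; suc; _+_; _*_; _∸_; _≤_; _<_; z≤n; _<?_; _≟_)
open import Data.Nat.Properties
open import Data.Nat.Tactic.RingSolver using (solve-∀)
open import Data.List using (List; []; _∷_; _++_; map; filter; cartesianProductWith)
open import Data.List.Extrema.Nat using (min; argmin-all; min≤xs)
open import Data.List.Membership.Propositional using (_∈_)
open import Data.List.Membership.Propositional.Properties
open import Data.List.Membership.DecPropositional _≟_ using (_∈?_)
open import Data.List.Relation.Unary.Any using (here; there)
open import Data.List.Relation.Unary.All as All using (all?)
open import Data.Product using (_×_; Σ; ∃₂; _,_; proj₁; proj₂)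
open import Data.Sum using (_⊎_; inj₁; inj₂)
open import Relation.Nullary using (yes; no; ¬_)
open import Relation.Nullary.Decidable using (_⊎-dec_)
open import Relation.Unary using (Decidable)
open import Relation.Binary.PropositionalEquality
open import Function using (_∘_)

-- With K = N max A and M = max B, NA is the window ⟨A⟩ ∩ (K − ⟨rev A⟩), so it
-- suffices to write every x ∈ NA as b + c with b ∈ B and c + B ⊆ NA; then
-- B divides NA with cofactor {c ∈ NA : c + B ⊆ NA}.  Choose b ∈ B largest with
-- b = 0 or x − b > F(S); then c + B ⊆ ⟨A⟩.  If b = M, then K − (c + b′) =
-- (K − x) + (M − b′) ∈ ⟨rev A⟩.  Otherwise the next element b + d of B is not
-- chosen, so x ≤ b + d + F(S), and the bound on the gap d puts K + b − x − M
-- above F(T), whence again K − (c + b′) = (K + b − x − M) + (M − b′) ∈ ⟨rev A⟩.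

⊕≡cartesianProductWith : ∀ X Y → X ⊕ Y ≡ cartesianProductWith _+_ X Y
⊕≡cartesianProductWith []      Y = refl
⊕≡cartesianProductWith (x ∷ X) Y = cong (map (x +_) Y ++_) (⊕≡cartesianProductWith X Y)

∈-⊕⁺ : ∀ {X Y a c} → a ∈ X → c ∈ Y → a + c ∈ X ⊕ Y
∈-⊕⁺ {X} {Y} a∈X c∈Y =
  subst (_ ∈_) (sym (⊕≡cartesianProductWith X Y)) (∈-cartesianProductWith⁺ _+_ a∈X c∈Y)

∈-⊕⁻ : ∀ X Y {z} → z ∈ X ⊕ Y → ∃₂ λ a c → a ∈ X × c ∈ Y × z ≡ a + c
∈-⊕⁻ X Y z∈X+Y =
  ∈-cartesianProductWith⁻ _+_ X Y (subst (_ ∈_) (⊕≡cartesianProductWith X Y) z∈X+Y)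

0∈·ₛ : ∀ {A} → 0 ∈ A → ∀ n → 0 ∈ n ·ₛ A
0∈·ₛ 0∈A zero    = here refl
0∈·ₛ 0∈A (suc n) = ∈-⊕⁺ 0∈A (0∈·ₛ 0∈A n)

∣ₚ-intro : ∀ {B D} → 0 ∈ B → 0 ∈ D →
  (∀ x → x ∈ D → ∃₂ λ b c → b ∈ B × x ≡ b + c × (∀ b′ → b′ ∈ B → c + b′ ∈ D)) →
  B ∣ₚ D
∣ₚ-intro {B} {D} 0∈B 0∈D split = C , 0∈C , λ x → split-into-C x , from-C x
  where
  C = filter (λ c → all? (λ b′ → c + b′ ∈? D) B) D

  0∈C : 0 ∈ C
  0∈C with split 0 0∈D
  ... | b , c , _ , 0≡b+c , c+B⊆D with m+n≡0⇒n≡0 b (sym 0≡b+c)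
  ...   | refl = ∈-filter⁺ _ 0∈D (All.tabulate (c+B⊆D _))

  split-into-C : ∀ x → x ∈ D → x ∈ B ⊕ C
  split-into-C x x∈D with split x x∈D
  ... | b , c , b∈B , refl , c+B⊆D =
    ∈-⊕⁺ b∈B (∈-filter⁺ _ (subst (_∈ D) (+-identityʳ c) (c+B⊆D 0 0∈B)) (All.tabulate (c+B⊆D _)))

  from-C : ∀ x → x ∈ B ⊕ C → x ∈ D
  from-C x x∈B+C with ∈-⊕⁻ B C x∈B+C
  ... | b , c , b∈B , c∈C , refl =
    subst (_∈ D) (+-comm c b) (All.lookup (proj₂ (∈-filter⁻ _ {xs = D} c∈C)) b∈B)

≤maxL : ∀ {B z} → z ∈ B → z ≤ maxL B
≤maxL {x ∷ B} (here refl) = m≤m⊔n x (maxL B)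
≤maxL {x ∷ B} (there z∈B) = ≤-trans (≤maxL z∈B) (m≤n⊔m x (maxL B))

maxL≤ : ∀ {B m} → (∀ z → z ∈ B → z ≤ m) → maxL B ≤ m
maxL≤ {[]}    B≤m = z≤n
maxL≤ {x ∷ B} B≤m = ⊔-lub (B≤m x (here refl)) (maxL≤ (λ z z∈B → B≤m z (there z∈B)))

maxL∈ : ∀ {B z} → z ∈ B → maxL B ∈ B
maxL∈ {B} z∈B with foldr-selective ⊔-sel 0 B
... | inj₂ maxB∈B = maxB∈B
... | inj₁ maxB≡0 =
  subst (_∈ B) (trans (n≤0⇒n≡0 (subst (_ ≤_) maxB≡0 (≤maxL z∈B))) (sym maxB≡0)) z∈B

⟨⟩-+ : ∀ {X a b} → ⟨ X ⟩ a → ⟨ X ⟩ b → ⟨ X ⟩ (a + b)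
⟨⟩-+ mon-zero q = q
⟨⟩-+ {b = b} (mon-add {x} {m} x∈X p) q rewrite +-assoc x m b = mon-add x∈X (⟨⟩-+ p q)

maxL-≈rev : ∀ {B B′} → 0 ∈ B′ → B ≈ₛ rev B′ → maxL B ≡ maxL B′
maxL-≈rev {B} {B′} 0∈B′ B≈revB′ = ≤-antisym (maxL≤ B≤maxB′) (≤maxL maxB′∈B)
  where
  maxB′∈B : maxL B′ ∈ B
  maxB′∈B = proj₂ (B≈revB′ _) (∈-map⁺ (maxL B′ ∸_) 0∈B′)

  B≤maxB′ : ∀ z → z ∈ B → z ≤ maxL B′
  B≤maxB′ z z∈B with ∈-map⁻ _ (proj₁ (B≈revB′ z) z∈B)
  ... | e , _ , refl = m∸n≤m (maxL B′) e

maxL∸-∈-≈rev : ∀ {B B′ b} → 0 ∈ B′ → B ≈ₛ rev B′ → b ∈ B → maxL B ∸ b ∈ B′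
maxL∸-∈-≈rev {B} {B′} 0∈B′ B≈revB′ b∈B with ∈-map⁻ _ (proj₁ (B≈revB′ _) b∈B)
... | e , e∈B′ , refl =
  subst (_∈ B′) (sym (trans (cong (_∸ (maxL B′ ∸ e)) (maxL-≈rev 0∈B′ B≈revB′))
                             (m∸[m∸n]≡n (≤maxL e∈B′)))) e∈B′

InΔ-next : ∀ {B a c} → a ∈ B → c ∈ B → a < c → (∀ e → e ∈ B → a < e → c ≤ e) → InΔ B (c ∸ a)
InΔ-next {B} {a} {c} a∈B c∈B a<c c-next =
  m<n⇒0<n∸m a<c , a , a∈B , subst (_∈ B) (sym a+d≡c) c∈B , only-ends
  where
  a+d≡c : a + (c ∸ a) ≡ c
  a+d≡c = m+[n∸m]≡n (<⇒≤ a<c)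

  only-ends : ∀ x → x ∈ B → a ≤ x → x ≤ a + (c ∸ a) → x ≡ a ⊎ x ≡ a + (c ∸ a)
  only-ends x x∈B a≤x x≤c with a ≟ x
  ... | yes refl = inj₁ refl
  ... | no a≢x   = inj₂ (≤-antisym x≤c (subst (_≤ x) (sym a+d≡c) (c-next x x∈B (≤∧≢⇒< a≤x a≢x))))

greatest-or-gap : ∀ {P : ℕ → Set} → Decidable P → ∀ {B z} → z ∈ B → P z →
  Σ ℕ λ b → b ∈ B × P b × (b ≡ maxL B ⊎ Σ ℕ λ d → InΔ B d × ¬ P (b + d))
greatest-or-gap {P} P? {B} z∈B Pz = b , b∈B , Pb , last-or-gap
  where
  b = maxL (filter P? B)
  b∈B×Pb = ∈-filter⁻ P? {xs = B} (maxL∈ (∈-filter⁺ P? z∈B Pz))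
  b∈B = proj₁ b∈B×Pb
  Pb = proj₂ b∈B×Pb
  M = maxL B

  later : List ℕ
  later = filter (b <?_) B

  next-gap : b < M → Σ ℕ λ d → InΔ B d × ¬ P (b + d)
  next-gap b<M = c ∸ b , InΔ-next b∈B c∈B b<c c-next , ¬Pc ∘ subst P (m+[n∸m]≡n (<⇒≤ b<c))
    where
    c = min M later
    c∈B×b<c : c ∈ B × b < c
    c∈B×b<c = argmin-all (λ n → n) (maxL∈ b∈B , b<M) (All.tabulate (∈-filter⁻ (b <?_) {xs = B}))
    c∈B = proj₁ c∈B×b<c
    b<c = proj₂ c∈B×b<c
    c-next : ∀ e → e ∈ B → b < e → c ≤ e
    c-next e e∈B b<e = All.lookup (min≤xs M later) (∈-filter⁺ (b <?_) e∈B b<e)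
    ¬Pc : ¬ P c
    ¬Pc Pc = <⇒≱ b<c (≤maxL (∈-filter⁺ P? c∈B Pc))

  last-or-gap : b ≡ M ⊎ Σ ℕ λ d → InΔ B d × ¬ P (b + d)
  last-or-gap with b ≟ M
  ... | yes b≡M = inj₁ b≡M
  ... | no b≢M  = inj₂ (next-gap (≤∧≢⇒< (≤maxL b∈B) b≢M))

≡0⊎<⇒≤ : ∀ {fS x b} → b ≡ 0 ⊎ fS + b < x → b ≤ x
≡0⊎<⇒≤ (inj₁ refl)   = z≤n
≡0⊎<⇒≤ {fS} {b = b} (inj₂ fS+b<x) = ≤-trans (m≤n+m b (suc fS)) fS+b<x

admissible-split : ∀ {B fS fT K} → 0 ∈ B → (∀ d → InΔ B d → d + fS + fT + maxL B < K) → ∀ x →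
  Σ ℕ λ b → b ∈ B × (b ≡ 0 ⊎ fS + b < x) × (b ≡ maxL B ⊎ fT + (x + maxL B) < K + b)
admissible-split {B} {fS} {fT} {K} 0∈B gap-bound x
  with greatest-or-gap (λ e → (e ≟ 0) ⊎-dec (fS + e <? x)) 0∈B (inj₁ refl)
... | b , b∈B , low , inj₁ b≡M = b , b∈B , low , inj₁ b≡M
... | b , b∈B , low , inj₂ (d , d∈Δ , ¬low) = b , b∈B , low , inj₂ (begin-strict
  fT + (x + M)                ≤⟨ +-monoʳ-≤ fT (+-monoˡ-≤ M (≮⇒≥ (¬low ∘ inj₂))) ⟩
  fT + (fS + (b + d) + M)     ≡⟨ regroup fT fS b d M ⟩
  b + (d + fS + fT + M)       <⟨ +-monoʳ-< b (gap-bound d d∈Δ) ⟩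
  b + K                       ≡⟨ +-comm b K ⟩
  K + b                       ∎)
  where
  open ≤-Reasoning
  M = maxL B
  regroup : ∀ fT fS b d M → fT + (fS + (b + d) + M) ≡ b + (d + fS + fT + M)
  regroup = solve-∀

InWindow : List ℕ → List ℕ → ℕ → ℕ → Set
InWindow X Y K y = ⟨ X ⟩ y × Σ ℕ λ t → ⟨ Y ⟩ t × y + t ≡ K

module _ {X Y : List ℕ} {fS fT K : ℕ}
  (tailS : ∀ y → fS < y → ⟨ X ⟩ y) (tailT : ∀ y → fT < y → ⟨ Y ⟩ y)
  {B : List ℕ} (B⊆S : ∀ b → b ∈ B → ⟨ X ⟩ b) (M∸B⊆T : ∀ b → b ∈ B → ⟨ Y ⟩ (maxL B ∸ b))
  where

  private
    M = maxL B

  shift-⟨⟩ : ∀ {x b b′} → ⟨ X ⟩ x → b ≡ 0 ⊎ fS + b < x → b′ ∈ B → ⟨ X ⟩ (x ∸ b + b′)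
  shift-⟨⟩ x∈S (inj₁ refl) b′∈B = ⟨⟩-+ x∈S (B⊆S _ b′∈B)
  shift-⟨⟩ {x} {b} {b′} _ (inj₂ fS+b<x) _ =
    tailS _ (≤-trans (m+n≤o⇒m≤o∸n (suc fS) fS+b<x) (m≤m+n (x ∸ b) b′))

  shift-complement : ∀ {x b b′ u} → b ≤ x → b′ ∈ B → x + M + u ≡ K + b → ⟨ Y ⟩ u →
    Σ ℕ λ t → ⟨ Y ⟩ t × x ∸ b + b′ + t ≡ K
  shift-complement {x} {b} {b′} {u} b≤x b′∈B x+M+u≡K+b u∈T =
    u + (M ∸ b′) , ⟨⟩-+ u∈T (M∸B⊆T _ b′∈B) , +-cancelˡ-≡ b _ _ (begin
      b + (x ∸ b + b′ + (u + (M ∸ b′)))  ≡⟨ regroup b (x ∸ b) b′ u (M ∸ b′) ⟩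
      (b + (x ∸ b)) + (b′ + (M ∸ b′)) + u ≡⟨ cong₂ (λ p q → p + q + u)
                                               (m+[n∸m]≡n b≤x) (m+[n∸m]≡n (≤maxL b′∈B)) ⟩
      x + M + u                          ≡⟨ x+M+u≡K+b ⟩
      K + b                              ≡⟨ +-comm K b ⟩
      b + K                              ∎)
    where
    open ≡-Reasoning
    regroup : ∀ b p b′ u q → b + (p + b′ + (u + q)) ≡ (b + p) + (b′ + q) + u
    regroup = solve-∀

  shift-window : ∀ {x b b′} → InWindow X Y K x → b ∈ B →
    b ≡ 0 ⊎ fS + b < x → b ≡ M ⊎ fT + (x + M) < K + b →
    b′ ∈ B → InWindow X Y K (x ∸ b + b′)
  shift-window {x} {b} (x∈S , t , t∈T , x+t≡K) b∈B low high b′∈B =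
    shift-⟨⟩ x∈S low b′∈B , complement high
    where
    swap : ∀ x M t → x + M + t ≡ x + t + M
    swap = solve-∀

    complement : b ≡ M ⊎ fT + (x + M) < K + b → Σ ℕ λ t′ → ⟨ Y ⟩ t′ × _ + t′ ≡ K
    complement (inj₁ refl) = shift-complement (≡0⊎<⇒≤ low) b′∈B
      (trans (swap x M t) (cong (_+ M) x+t≡K)) t∈T
    complement (inj₂ lt) = shift-complement (≡0⊎<⇒≤ low) b′∈B
      (m+[n∸m]≡n (≤-trans (m≤n+m (x + M) (suc fT)) lt))
      (tailT _ (m+n≤o⇒m≤o∸n (suc fT) lt))

lemma4p4 : (A : List ℕ) → 0 ∈ A → gcdL A ≡ 1 →
    (nstar : ℕ) → 1 ≤ nstar →
    (∀ n → nstar ≤ n → ∀ x →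
      (x ∈ (n ·ₛ A) → ⟨ A ⟩ x × (Σ ℕ λ t → ⟨ rev A ⟩ t × x + t ≡ n * maxL A)) ×
      ((⟨ A ⟩ x × (Σ ℕ λ t → ⟨ rev A ⟩ t × x + t ≡ n * maxL A)) → x ∈ (n ·ₛ A))) →
    (fS fT : ℕ) → IsFrobenius ⟨ A ⟩ fS → IsFrobenius ⟨ rev A ⟩ fT →
    (B : List ℕ) → InPfin0 A B →
    (Σ (List ℕ) λ B′ → InPfin0 (rev A) B′ × B ≈ₛ rev B′) →
    (N : ℕ) → nstar ≤ N →
    (∀ d → InΔ B d → d + fS + fT + maxL B < N * maxL A) →
    B ∣ₚ (N ·ₛ A)
lemma4p4 A 0∈A _ nstar _ NA⇔window fS fT (tailS , _) (tailT , _)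
         B (0∈B , B⊆S) (B′ , (0∈B′ , B′⊆T) , B≈revB′) N nstar≤N gap-bound =
  ∣ₚ-intro 0∈B (0∈·ₛ 0∈A N) split
  where
  M∸B⊆T : ∀ b → b ∈ B → ⟨ rev A ⟩ (maxL B ∸ b)
  M∸B⊆T b b∈B = B′⊆T _ (maxL∸-∈-≈rev 0∈B′ B≈revB′ b∈B)

  split : ∀ x → x ∈ N ·ₛ A → ∃₂ λ b c → b ∈ B × x ≡ b + c × (∀ b′ → b′ ∈ B → c + b′ ∈ N ·ₛ A)
  split x x∈NA with admissible-split 0∈B gap-bound x
  ... | b , b∈B , low , high = b , x ∸ b , b∈B , sym (m+[n∸m]≡n (≡0⊎<⇒≤ low)) ,
    λ b′ b′∈B → proj₂ (NA⇔window N nstar≤N _)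
      (shift-window tailS tailT B⊆S M∸B⊆T (proj₁ (NA⇔window N nstar≤N x) x∈NA) b∈B low high b′∈B)
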